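{- Let $H$ be a colored graph with no $c$-flower centered at any color class, for some $c\ge1$. If $H$ contains a half-colorful $k$-matching centered at color class $C_0$, then there exist a set $S\subseteq C_0$ with $|S|\le3c$, vertices $x_1,\dots,x_{k-3c}$ in $C_0$, and $k-3c$ color classes $C_{i_1},\dots,C_{i_{k-3c}}$ such that, for each $j$, $x_j$ is the unique vertex of $C_0\setminus S$ that has a neighbor in $C_{i_j}$.
   Context: A colored graph is a finite simple graph with a (not necessarily proper) vertex coloring. $H^{\bullet\setminus i}$ is obtained from $H$ by making every color class except $C_i$ a clique. A $c$-flower centered at $C_i$ is a collection of $c$ pairwise vertex-disjoint paths of length at least $1$ in $H^{\bullet\setminus i}$, each with both endpoints in $C_i$. A half-colorful $k$-matching centered at $C_0$ is a matching $x_1y_1,\dots,x_ky_k$ in $H$ with all $x_i\in C_0$ and $y_1,\dots,y_k$ in pairwise distinct color classes different from $C_0$. -}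

module Defs where

open import Data.Nat using (ℕ; suc; _≤_)
open import Data.Bool using (Bool; T; true; false)
open import Data.Fin using (Fin)
open import Data.Fin.Subset using (Subset)
open import Data.List using (List; []; _∷_; head; last)
open import Data.List.Relation.Unary.Unique.Propositional using (Unique)
open import Data.List.Membership.Propositional using (_∈_)
open import Data.Maybe using (just)
open import Data.Product using (Σ; _×_; ∃)
open import Data.Empty using (⊥)
open import Relation.Nullary using (¬_)
open import Relation.Binary.PropositionalEquality using (_≡_; _≢_)

-- A colored graph: finite simple graph on vertex set Fin n, together with a
-- (not necessarily proper) coloring by colors Fin m.
-- Color class C_i = { v | color v ≡ i } (classes may be empty).
record ColoredGraph (n m : ℕ) : Set where
  field
    adj    : Fin n → Fin n → Bool
    sym    : ∀ u v → adj u v ≡ adj v u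
    irrefl : ∀ v → adj v v ≡ false
    color  : Fin n → Fin m

module _ {n m : ℕ} (H : ColoredGraph n m) where
  open ColoredGraph H

  Edge : Fin n → Fin n → Set
  Edge u v = T (adj u v)

  -- adjacency in H^{•∖i}: every color class other than C_i made a clique
  EdgeBullet : Fin m → Fin n → Fin n → Set
  EdgeBullet i u v = u ≢ v × (Edge u v Data.Sum.⊎ (color u ≡ color v × color u ≢ i))
    where import Data.Sum

  data Walk (R : Fin n → Fin n → Set) : List (Fin n) → Set where
    single : ∀ v → Walk R (v ∷ [])
    step   : ∀ u v vs → R u v → Walk R (v ∷ vs) → Walk R (u ∷ v ∷ vs)

  -- a path of length ≥ 1 in H^{•∖i} with both endpoints in C_i,
  -- given by its (pairwise distinct) vertex sequence
  record FlowerPath (i : Fin m) : Set where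
    field
      verts     : List (Fin n)
      first     : Fin n
      second    : Fin n
      rest      : List (Fin n)
      shape     : verts ≡ first ∷ second ∷ rest
      walk      : Walk (EdgeBullet i) verts
      distinct  : Unique verts
      lastV     : Fin n
      lastIs    : last verts ≡ just lastV
      firstCol  : color first ≡ i
      lastCol   : color lastV ≡ i

  Flower : ℕ → Fin m → Set
  Flower c i =
    Σ (Fin c → FlowerPath i) λ P →
      ∀ a b → a ≢ b → ∀ v → v ∈ FlowerPath.verts (P a) → ¬ (v ∈ FlowerPath.verts (P b))

  HalfColorfulMatching : ℕ → Fin m → Set
  HalfColorfulMatching k i0 =
    Σ (Fin k → Fin n) λ x → Σ (Fin k → Fin n) λ y →
      (∀ j → Edge (x j) (y j)) ×
      (∀ a b → x a ≡ x b → a ≡ b) ×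
      (∀ a b → y a ≡ y b → a ≡ b) ×
      (∀ a b → x a ≢ y b) ×
      (∀ j → color (x j) ≡ i0) ×
      (∀ a b → color (y a) ≡ color (y b) → a ≡ b) ×
      (∀ j → color (y j) ≢ i0)

  HasNbrIn : Fin n → Fin m → Set
  HasNbrIn v i = ∃ λ w → color w ≡ i × Edge v w

module Submission where

-- Call a vertex v ∈ C_0 with v ≠ x_a and a neighbour w in the
-- class D_a of y_a a petal at a: then x_a y_a (w) v is a path of H^{•∖0}, since
-- D_a is a clique there, with both ends in C_0.  Starting from S = ∅ we repeatedly
-- pick a petal (a, v) with x_a, v ∉ S and add x_a and v to S.  Petals chosen in
-- this way have disjoint ends {x_a, v}, and their middle vertices lie in the
-- pairwise distinct classes D_a ≠ C_0, so c of them would form a c-flower at C_0.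
-- Hence the process stops after t < c rounds with |S| ≤ 2t ≤ 3c and no petal left
-- outside S.  Then every index a with x_a ∉ S has x_a as the only vertex of
-- C_0 ∖ S with a neighbour in D_a, and since x is injective at least k - |S|
-- indices satisfy x_a ∉ S.

open import Defs
open import Data.Nat using (ℕ; zero; suc; _+_; _*_; _∸_; _≤_; z≤n; s≤s)
open import Data.Nat.Properties
  using (≤-trans; ≤-reflexive; +-suc; +-comm; +-monoʳ-≤; +-mono-≤; m≤m+n; m≤n+m;
         ∸-monoʳ-≤; pred-mono-≤; n≮0; 0∸n≡0; pred[m∸n]≡m∸[1+n])
open import Data.Bool using (true; false; T)
open import Data.Bool.Properties using (T?)
open import Data.Fin using (Fin; zero; suc) renaming (_≟_ to _≟F_)
open import Data.Fin.Properties using (any?; suc-injective; 0≢1+n)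
open import Data.Fin.Subset using (Subset; _∈_; _∉_; ∣_∣; _∪_; ⁅_⁆; _-_) renaming (⊥ to ∅)
open import Data.Fin.Subset.Properties
  using (_∈?_; ∉⊥; ∣⊥∣≡0; ∣p∣≤∣x∷p∣; ∣⁅x⁆∣≡1; x∈⁅x⁆; x∈⁅y⁆⇒x≡y; x∈p∪q⁻; x∈p∪q⁺;
         x∈p∧x≢y⇒x∈p-y; x∈p⇒∣p-x∣<∣p∣)
open import Data.Vec using ([]; _∷_)
open import Data.Product using (Σ; _×_; _,_; proj₁; proj₂)
open import Data.Sum using (_⊎_; inj₁; inj₂)
open import Data.Empty using (⊥-elim)
open import Data.List using ([]; _∷_)
open import Data.List.Relation.Unary.Any using (here; there)
open import Data.List.Membership.Propositional using () renaming (_∈_ to _∈L_)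
open import Data.List.Relation.Unary.All using ([]; _∷_)
open import Data.List.Relation.Unary.AllPairs using ([]; _∷_)
open import Relation.Nullary using (¬_; Dec; yes; no)
open import Relation.Nullary.Decidable using (_×-dec_; ¬?)
open import Relation.Binary.PropositionalEquality
  using (_≡_; _≢_; refl; sym; trans; cong; subst)

IsInjective : ∀ {k n} → (Fin k → Fin n) → Set
IsInjective f = ∀ a b → f a ≡ f b → a ≡ b

∣p∪q∣≤∣p∣+∣q∣ : ∀ {n} (p q : Subset n) → ∣ p ∪ q ∣ ≤ ∣ p ∣ + ∣ q ∣
∣p∪q∣≤∣p∣+∣q∣ [] [] = z≤n
∣p∪q∣≤∣p∣+∣q∣ (true ∷ p) (b ∷ q) =
  s≤s (≤-trans (∣p∪q∣≤∣p∣+∣q∣ p q) (+-monoʳ-≤ ∣ p ∣ (∣p∣≤∣x∷p∣ b q)))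
∣p∪q∣≤∣p∣+∣q∣ (false ∷ p) (true ∷ q) =
  ≤-trans (s≤s (∣p∪q∣≤∣p∣+∣q∣ p q)) (≤-reflexive (sym (+-suc ∣ p ∣ ∣ q ∣)))
∣p∪q∣≤∣p∣+∣q∣ (false ∷ p) (false ∷ q) = ∣p∪q∣≤∣p∣+∣q∣ p q

∣p∪⁅x⁆∣≤1+∣p∣ : ∀ {n} (p : Subset n) (v : Fin n) → ∣ p ∪ ⁅ v ⁆ ∣ ≤ suc ∣ p ∣
∣p∪⁅x⁆∣≤1+∣p∣ p v = ≤-trans (∣p∪q∣≤∣p∣+∣q∣ p ⁅ v ⁆)
  (≤-reflexive (trans (cong (∣ p ∣ +_) (∣⁅x⁆∣≡1 v)) (+-comm ∣ p ∣ 1)))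

-- An injection f : Fin k → Fin n hits a set S at most ∣ S ∣ times, so any
-- r ≤ k ∸ ∣ S ∣ indices whose images avoid S can be chosen injectively.
indices-avoiding : ∀ {k n} (f : Fin k → Fin n) → IsInjective f → (S : Subset n) →
  ∀ {r} → r ≤ k ∸ ∣ S ∣ → Σ (Fin r → Fin k) λ h → IsInjective h × (∀ j → f (h j) ∉ S)
indices-avoiding {zero} f f-inj S {zero} _ = (λ ()) , (λ ()) , (λ ())
indices-avoiding {zero} f f-inj S {suc r} r<0∸∣S∣ = ⊥-elim (n≮0 (≤-trans r<0∸∣S∣ (≤-reflexive (0∸n≡0 ∣ S ∣))))
indices-avoiding {suc k} f f-inj S {r} r≤k+1∸∣S∣ with f zero ∈? S
... | yes f0∈S =
  let h , h-inj , avoid = indices-avoiding (λ a → f (suc a)) f∘suc-inj (S - f zero)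
        (≤-trans r≤k+1∸∣S∣ (∸-monoʳ-≤ (suc k) (x∈p⇒∣p-x∣<∣p∣ f0∈S)))
  in (λ j → suc (h j)) , (λ a b eq → h-inj a b (suc-injective eq)) ,
     (λ j fj∈S → avoid j (x∈p∧x≢y⇒x∈p-y fj∈S (λ eq → 0≢1+n (sym (f-inj _ _ eq)))))
  where
  f∘suc-inj : IsInjective (λ a → f (suc a))
  f∘suc-inj a b eq = suc-injective (f-inj _ _ eq)
... | no f0∉S with r
...   | zero = (λ ()) , (λ ()) , (λ ())
...   | suc r′ =
  let h , h-inj , avoid = indices-avoiding (λ a → f (suc a)) f∘suc-inj S
        (≤-trans (pred-mono-≤ r≤k+1∸∣S∣) (≤-reflexive (pred[m∸n]≡m∸[1+n] (suc k) ∣ S ∣)))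
      h′ : Fin (suc r′) → Fin (suc k)
      h′ = λ { zero → zero ; (suc j) → suc (h j) }
      h′-inj : IsInjective h′
      h′-inj = λ { zero zero _ → refl
                 ; (suc a) (suc b) eq → cong suc (h-inj a b (suc-injective eq)) }
  in h′ , h′-inj , λ { zero → f0∉S ; (suc j) → avoid j }
  where
  f∘suc-inj : IsInjective (λ a → f (suc a))
  f∘suc-inj a b eq = suc-injective (f-inj _ _ eq)

module _ {n m : ℕ} (H : ColoredGraph n m) where
  open ColoredGraph H using (color)

  edge-sym : ∀ {u v} → Edge H u v → Edge H v u
  edge-sym {u} {v} = subst T (ColoredGraph.sym H u v)

  colors-differ : ∀ {u v} → color u ≢ color v → u ≢ v
  colors-differ ne refl = ne refl

  -- Let p ≠ q lie in C_i and let s, w lie in a common class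
  -- D ≠ C_i with p ~ s and q ~ w in H.  Then p s q (if s = w) or p s w q is a
  -- path of H^{•∖i}, using the clique on D for the edge s w.
  petal-path : ∀ i {p q s w} → color p ≡ i → color q ≡ i → p ≢ q →
    color w ≡ color s → color s ≢ i → Edge H p s → Edge H q w →
    Σ (FlowerPath H i) λ P → ∀ u → u ∈L FlowerPath.verts P → (u ≡ p ⊎ u ≡ q) ⊎ color u ≡ color s
  petal-path i {p} {q} {s} {w} p∈i q∈i p≢q w∼s s∉i ps qw with w ≟F s
  ... | yes refl = path , vertices
    where
    p≢s : p ≢ s
    p≢s = colors-differ λ eq → s∉i (trans (sym eq) p∈i)
    s≢q : s ≢ q
    s≢q = colors-differ λ eq → s∉i (trans eq q∈i)
    path : FlowerPath H i
    path = record
      { verts = p ∷ s ∷ q ∷ [] ; first = p ; second = s ; rest = q ∷ [] ; shape = refl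
      ; walk = step _ _ _ (p≢s , inj₁ ps) (step _ _ _ (s≢q , inj₁ (edge-sym qw)) (single _))
      ; distinct = (p≢s ∷ p≢q ∷ []) ∷ (s≢q ∷ []) ∷ [] ∷ []
      ; lastV = q ; lastIs = refl ; firstCol = p∈i ; lastCol = q∈i }
    vertices : ∀ u → u ∈L FlowerPath.verts path → (u ≡ p ⊎ u ≡ q) ⊎ color u ≡ color s
    vertices u (here refl) = inj₁ (inj₁ refl)
    vertices u (there (here refl)) = inj₂ refl
    vertices u (there (there (here refl))) = inj₁ (inj₂ refl)
  ... | no w≢s = path , vertices
    where
    p≢s : p ≢ s
    p≢s = colors-differ λ eq → s∉i (trans (sym eq) p∈i)
    p≢w : p ≢ w
    p≢w = colors-differ λ eq → s∉i (trans (sym (trans eq w∼s)) p∈i)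
    s≢w : s ≢ w
    s≢w = λ eq → w≢s (sym eq)
    s≢q : s ≢ q
    s≢q = colors-differ λ eq → s∉i (trans eq q∈i)
    w≢q : w ≢ q
    w≢q = colors-differ λ eq → s∉i (trans (sym w∼s) (trans eq q∈i))
    path : FlowerPath H i
    path = record
      { verts = p ∷ s ∷ w ∷ q ∷ [] ; first = p ; second = s ; rest = w ∷ q ∷ [] ; shape = refl
      ; walk = step _ _ _ (p≢s , inj₁ ps)
                 (step _ _ _ (s≢w , inj₂ (sym w∼s , s∉i))
                   (step _ _ _ (w≢q , inj₁ (edge-sym qw)) (single _)))
      ; distinct = (p≢s ∷ p≢w ∷ p≢q ∷ []) ∷ (s≢w ∷ s≢q ∷ []) ∷ (w≢q ∷ []) ∷ [] ∷ []
      ; lastV = q ; lastIs = refl ; firstCol = p∈i ; lastCol = q∈i }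
    vertices : ∀ u → u ∈L FlowerPath.verts path → (u ≡ p ⊎ u ≡ q) ⊎ color u ≡ color s
    vertices u (here refl) = inj₁ (inj₁ refl)
    vertices u (there (here refl)) = inj₂ refl
    vertices u (there (there (here refl))) = inj₂ w∼s
    vertices u (there (there (there (here refl)))) = inj₁ (inj₂ refl)

module GreedyPetals {n m : ℕ} (H : ColoredGraph n m) (c k : ℕ) (i0 : Fin m)
  (x y : Fin k → Fin n)
  (matched : ∀ j → Edge H (x j) (y j))
  (x-inj : IsInjective x)
  (x∈C0 : ∀ j → ColoredGraph.color H (x j) ≡ i0)
  (classes-distinct : ∀ a b → ColoredGraph.color H (y a) ≡ ColoredGraph.color H (y b) → a ≡ b)
  (y∉C0 : ∀ j → ColoredGraph.color H (y j) ≢ i0)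
  (no-flower : ¬ Flower H c i0)
  where
  open ColoredGraph H using (color; adj)

  D : Fin k → Fin m
  D a = color (y a)

  record Petal : Set where
    field
      index : Fin k
      tip : Fin n
      tip∈C0 : color tip ≡ i0
      tip≢x : tip ≢ x index
      tip-nbr : HasNbrIn H tip (D index)
  open Petal

  Ends : Petal → Fin n → Set
  Ends P u = u ≡ x (index P) ⊎ u ≡ tip P

  ends∈C0 : ∀ P {u} → Ends P u → color u ≡ i0
  ends∈C0 P (inj₁ refl) = x∈C0 (index P)
  ends∈C0 P (inj₂ refl) = tip∈C0 P

  -- c petals with pairwise disjoint ends form a c-flower centered at C_0: the
  -- inner vertices of the petal paths lie in the distinct classes D a ≠ C_0.
  flower : (P : Fin c → Petal) → (∀ p q → p ≢ q → ∀ u → Ends (P p) u → ¬ Ends (P q) u) →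
    Flower H c i0
  flower P disjoint = (λ p → proj₁ (path p)) , paths-disjoint
    where
    path : ∀ p → Σ (FlowerPath H i0) λ Q → ∀ u → u ∈L FlowerPath.verts Q →
      Ends (P p) u ⊎ color u ≡ D (index (P p))
    path p with tip-nbr (P p)
    ... | w , w∈D , tip∼w = petal-path H i0 (x∈C0 a) (tip∈C0 (P p))
            (λ eq → tip≢x (P p) (sym eq)) w∈D (y∉C0 a) (matched a) tip∼w
      where a = index (P p)
    paths-disjoint : ∀ p q → p ≢ q → ∀ u → u ∈L FlowerPath.verts (proj₁ (path p)) →
      ¬ (u ∈L FlowerPath.verts (proj₁ (path q)))
    paths-disjoint p q p≢q u u∈p u∈q with proj₂ (path p) u u∈p | proj₂ (path q) u u∈q
    ... | inj₁ end-p | inj₁ end-q = disjoint p q p≢q u end-p end-q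
    ... | inj₁ end-p | inj₂ u∈Dq = y∉C0 (index (P q)) (trans (sym u∈Dq) (ends∈C0 (P p) end-p))
    ... | inj₂ u∈Dp | inj₁ end-q = y∉C0 (index (P p)) (trans (sym u∈Dp) (ends∈C0 (P q) end-q))
    ... | inj₂ u∈Dp | inj₂ u∈Dq = disjoint p q p≢q (x (index (P p))) (inj₁ refl)
            (inj₁ (cong x (classes-distinct _ _ (trans (sym u∈Dp) u∈Dq))))

  record State (t : ℕ) : Set where
    field
      petals : Fin t → Petal
      S : Subset n
      S⊆C0 : ∀ u → u ∈ S → color u ≡ i0
      ∣S∣≤2t : ∣ S ∣ ≤ t + t
      ends∈S : ∀ p u → Ends (petals p) u → u ∈ S
      disjoint : ∀ p q → p ≢ q → ∀ u → Ends (petals p) u → ¬ Ends (petals q) u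

  start : State 0
  start = record
    { petals = λ () ; S = ∅ ; S⊆C0 = λ u u∈∅ → ⊥-elim (∉⊥ u∈∅) ; ∣S∣≤2t = ≤-reflexive (∣⊥∣≡0 n)
    ; ends∈S = λ () ; disjoint = λ () }

  Extension : Subset n → Set
  Extension S = Σ (Fin k) λ a → Σ (Fin n) λ v →
    x a ∉ S × color v ≡ i0 × v ∉ S × v ≢ x a × HasNbrIn H v (D a)

  Saturated : Subset n → Set
  Saturated S = ∀ a v → x a ∉ S → color v ≡ i0 → v ∉ S → HasNbrIn H v (D a) → v ≡ x a

  extension? : ∀ S → Dec (Extension S)
  extension? S = any? λ a → any? λ v →
    ¬? (x a ∈? S) ×-dec (color v ≟F i0) ×-dec ¬? (v ∈? S) ×-dec ¬? (v ≟F x a) ×-dec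
    any? (λ w → (color w ≟F D a) ×-dec T? (adj v w))

  saturated-or-extendable : ∀ S → Saturated S ⊎ Extension S
  saturated-or-extendable S with extension? S
  ... | yes ext = inj₂ ext
  ... | no no-ext = inj₁ saturated
    where
    saturated : Saturated S
    saturated a v xa∉S v∈C0 v∉S v∼Da with v ≟F x a
    ... | yes v≡xa = v≡xa
    ... | no v≢xa = ⊥-elim (no-ext (a , v , xa∉S , v∈C0 , v∉S , v≢xa , v∼Da))

  extend : ∀ {t} (st : State t) → Extension (State.S st) → State (suc t)
  extend {t} st (a , v , xa∉S , v∈C0 , v∉S , v≢xa , v∼Da) = record
    { petals = petals′
    ; S = S′
    ; S⊆C0 = S′⊆C0
    ; ∣S∣≤2t = ≤-trans (∣p∪⁅x⁆∣≤1+∣p∣ (S ∪ ⁅ x a ⁆) v)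
                 (≤-trans (s≤s (∣p∪⁅x⁆∣≤1+∣p∣ S (x a)))
                   (≤-trans (s≤s (s≤s ∣S∣≤2t)) (≤-reflexive (cong suc (sym (+-suc t t))))))
    ; ends∈S = ends∈S′
    ; disjoint = disjoint′
    }
    where
    open State st
    new : Petal
    new = record { index = a ; tip = v ; tip∈C0 = v∈C0 ; tip≢x = v≢xa ; tip-nbr = v∼Da }
    petals′ : Fin (suc t) → Petal
    petals′ zero = new
    petals′ (suc p) = petals p
    S′ : Subset n
    S′ = (S ∪ ⁅ x a ⁆) ∪ ⁅ v ⁆
    S′⊆C0 : ∀ u → u ∈ S′ → color u ≡ i0
    S′⊆C0 u u∈S′ with x∈p∪q⁻ (S ∪ ⁅ x a ⁆) ⁅ v ⁆ u∈S′
    ... | inj₂ u∈v = subst (λ z → color z ≡ i0) (sym (x∈⁅y⁆⇒x≡y v u∈v)) v∈C0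
    ... | inj₁ u∈S∪xa with x∈p∪q⁻ S ⁅ x a ⁆ u∈S∪xa
    ...   | inj₁ u∈S = S⊆C0 u u∈S
    ...   | inj₂ u∈xa = subst (λ z → color z ≡ i0) (sym (x∈⁅y⁆⇒x≡y (x a) u∈xa)) (x∈C0 a)
    ends∈S′ : ∀ p u → Ends (petals′ p) u → u ∈ S′
    ends∈S′ zero u (inj₁ refl) = x∈p∪q⁺ (inj₁ (x∈p∪q⁺ (inj₂ (x∈⁅x⁆ (x a)))))
    ends∈S′ zero u (inj₂ refl) = x∈p∪q⁺ (inj₂ (x∈⁅x⁆ v))
    ends∈S′ (suc p) u end = x∈p∪q⁺ (inj₁ (x∈p∪q⁺ (inj₁ (ends∈S p u end))))
    new-ends∉S : ∀ u → Ends new u → u ∉ S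
    new-ends∉S u (inj₁ refl) = xa∉S
    new-ends∉S u (inj₂ refl) = v∉S
    disjoint′ : ∀ p q → p ≢ q → ∀ u → Ends (petals′ p) u → ¬ Ends (petals′ q) u
    disjoint′ zero zero p≢q = ⊥-elim (p≢q refl)
    disjoint′ zero (suc q) _ u end-p end-q = new-ends∉S u end-p (ends∈S q u end-q)
    disjoint′ (suc p) zero _ u end-p end-q = new-ends∉S u end-q (ends∈S p u end-p)
    disjoint′ (suc p) (suc q) p≢q = disjoint p q (λ eq → p≢q (cong suc eq))

  record Separator : Set where
    field
      S : Subset n
      S⊆C0 : ∀ u → u ∈ S → color u ≡ i0
      ∣S∣≤2c : ∣ S ∣ ≤ c + c
      saturated : Saturated S

  -- Run at most r more rounds from a state with t petals, where r + t = c; the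
  -- state with c petals would be a flower, so the procedure must stop earlier.
  run : ∀ r {t} → r + t ≡ c → State t → Separator
  run zero refl st = ⊥-elim (no-flower (flower (State.petals st) (State.disjoint st)))
  run (suc r) {t} r+t≡c st with saturated-or-extendable (State.S st)
  ... | inj₁ saturated = record
          { S = State.S st ; S⊆C0 = State.S⊆C0 st ; saturated = saturated
          ; ∣S∣≤2c = ≤-trans (State.∣S∣≤2t st) (+-mono-≤ t≤c t≤c) }
    where
    t≤c : t ≤ c
    t≤c = ≤-trans (m≤n+m t (suc r)) (≤-reflexive r+t≡c)
  ... | inj₂ ext = run r (trans (+-suc r t) r+t≡c) (extend st ext)

  Conclusion : Set
  Conclusion = Σ (Subset n) λ S → Σ (Fin (k ∸ 3 * c) → Fin n) λ x′ → Σ (Fin (k ∸ 3 * c) → Fin m) λ cls →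
    (∀ v → v ∈ S → color v ≡ i0) ×
    ∣ S ∣ ≤ 3 * c ×
    (∀ a b → x′ a ≡ x′ b → a ≡ b) ×
    (∀ a b → cls a ≡ cls b → a ≡ b) ×
    (∀ j → cls j ≢ i0) ×
    (∀ j → color (x′ j) ≡ i0) ×
    (∀ j → x′ j ∉ S) ×
    (∀ j → HasNbrIn H (x′ j) (cls j)) ×
    (∀ j v → color v ≡ i0 → v ∉ S → HasNbrIn H v (cls j) → v ≡ x′ j)

  conclusion : Separator → Conclusion
  conclusion sep =
    S , (λ j → x (h j)) , (λ j → D (h j)) , S⊆C0 , ∣S∣≤3c ,
    (λ a b eq → h-inj a b (x-inj _ _ eq)) ,
    (λ a b eq → h-inj a b (classes-distinct _ _ eq)) ,
    (λ j → y∉C0 (h j)) ,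
    (λ j → x∈C0 (h j)) ,
    avoid ,
    (λ j → y (h j) , refl , matched (h j)) ,
    (λ j v v∈C0 v∉S v∼Dj → saturated (h j) v (avoid j) v∈C0 v∉S v∼Dj)
    where
    open Separator sep
    ∣S∣≤3c : ∣ S ∣ ≤ 3 * c
    ∣S∣≤3c = ≤-trans ∣S∣≤2c (+-monoʳ-≤ c (m≤m+n c (c + 0)))
    chosen : Σ (Fin (k ∸ 3 * c) → Fin k) λ h → IsInjective h × (∀ j → x (h j) ∉ S)
    chosen = indices-avoiding x x-inj S (∸-monoʳ-≤ k ∣S∣≤3c)
    h : Fin (k ∸ 3 * c) → Fin k
    h = proj₁ chosen
    h-inj : IsInjective h
    h-inj = proj₁ (proj₂ chosen)
    avoid : ∀ j → x (h j) ∉ S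
    avoid = proj₂ (proj₂ chosen)

lemma6p14 : {n m : ℕ} (H : ColoredGraph n m) (c : ℕ) → 1 ≤ c →
    (∀ i → ¬ Flower H c i) →
    (k : ℕ) (i0 : Fin m) → HalfColorfulMatching H k i0 →
    Σ (Subset n) λ S → Σ (Fin (k ∸ 3 * c) → Fin n) λ x → Σ (Fin (k ∸ 3 * c) → Fin m) λ cls →
      (∀ v → v ∈ S → ColoredGraph.color H v ≡ i0) ×
      ∣ S ∣ ≤ 3 * c ×
      (∀ a b → x a ≡ x b → a ≡ b) ×
      (∀ a b → cls a ≡ cls b → a ≡ b) ×
      (∀ j → cls j ≢ i0) ×
      (∀ j → ColoredGraph.color H (x j) ≡ i0) ×
      (∀ j → x j ∉ S) ×
      (∀ j → HasNbrIn H (x j) (cls j)) ×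
      (∀ j v → ColoredGraph.color H v ≡ i0 → v ∉ S → HasNbrIn H v (cls j) → v ≡ x j)
lemma6p14 H c _ no-flower k i0 (x , y , matched , x-inj , _ , _ , x∈C0 , classes-distinct , y∉C0) =
  conclusion (run c (+-comm c 0) start)
  where
  open GreedyPetals H c k i0 x y matched x-inj x∈C0 classes-distinct y∉C0 (no-flower i0)
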